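{- Let $\lambda=2^m1^{n-m}$ with $0\le m\le n$, and let $T$ be a standard Young tableau of shape $\lambda$ with first-column entries $a_1,\dots,a_n$ read from top to bottom. Then $T$ is uniquely determined by the sequence $(\operatorname{dep}(a_1),\dots,\operatorname{dep}(a_n))$; that is, distinct tableaux in $S(\lambda)$ have distinct such sequences.
   Context: $\lambda=2^m1^{n-m}$ is the shape with $m$ rows of length $2$ followed by $n-m$ rows of length $1$. $S(\lambda)$ is the set of standard Young tableaux of shape $\lambda$ (fillings by $1,\dots,n+m$ increasing along rows and down columns). For an entry $a$ in column $j$, $\operatorname{dep}(a)$ is the number of entries of column $j$ smaller than $a$ minus the number of entries of column $j+1$ smaller than $a$ (the latter $0$ if there is no column $j+1$). -}

module Defs where

open import Data.Nat using (ℕ; zero; suc; _+_; _≤_; _<_)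
open import Data.Fin using (Fin; toℕ; inject≤)
open import Data.Fin.Base using (_<_)
open import Data.Sum using (_⊎_)
open import Data.Product using (Σ; _×_; ∃)
open import Data.List using (List; length; filter; allFin)
open import Data.Integer using (ℤ; +_; _-_)
open import Relation.Binary.PropositionalEquality using (_≡_; _≢_)
open import Data.Nat.Properties using (_<?_)

-- A standard Young tableau of shape λ = 2^m 1^(n-m) (m ≤ n), with n + m cells
-- filled by 1, …, n+m.
-- col1 i = entry in row i (0-indexed), column 1   (i : Fin n)
-- col2 j = entry in row j (0-indexed), column 2   (j : Fin m)
record SYT (n m : ℕ) (m≤n : m ≤ n) : Set where
  field
    col1 : Fin n → ℕ
    col2 : Fin m → ℕ
    col1-range : ∀ i → 1 ≤ col1 i × col1 i ≤ n + m
    col2-range : ∀ j → 1 ≤ col2 j × col2 j ≤ n + m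
    surj : ∀ k → 1 ≤ k → k ≤ n + m →
           (∃ λ i → col1 i ≡ k) ⊎ (∃ λ j → col2 j ≡ k)
    inj1 : ∀ i i' → col1 i ≡ col1 i' → i ≡ i'
    inj2 : ∀ j j' → col2 j ≡ col2 j' → j ≡ j'
    inj12 : ∀ i j → col1 i ≢ col2 j
    col1-incr : ∀ i i' → i Data.Fin.Base.< i' → col1 i Data.Nat.< col1 i'
    col2-incr : ∀ j j' → j Data.Fin.Base.< j' → col2 j Data.Nat.< col2 j'
    -- increasing along rows (row j has two cells iff j < m)
    row-incr : ∀ j → col1 (inject≤ j m≤n) Data.Nat.< col2 j

open SYT public

countBelow : {k : ℕ} → (Fin k → ℕ) → ℕ → ℕ
countBelow {k} c a = length (filter (λ i → c i <? a) (allFin k))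

dep1 : ∀ {n m m≤n} → SYT n m m≤n → Fin n → ℤ
dep1 T i = + countBelow (col1 T) (col1 T i) - + countBelow (col2 T) (col1 T i)

depSeq : ∀ {n m m≤n} → SYT n m m≤n → Fin n → ℤ
depSeq T i = dep1 T i

SameTableau : ∀ {n m m≤n} → SYT n m m≤n → SYT n m m≤n → Set
SameTableau T U = (∀ i → col1 T i ≡ col1 U i) × (∀ j → col2 T j ≡ col2 U j)

module Submission where

-- With rows indexed from 0: every entry x of T is preceded by exactly x − 1
-- smaller entries, i of them in column 1 if x = aᵢ since columns increase. Hence
-- aᵢ = 1 + i + #(column-2 entries < aᵢ) while dep(aᵢ) = i − #(column-2 entries < aᵢ),
-- so the dep sequence determines the first column. The second column is its
-- complement in {1, …, n+m}, and the row of each of its entries b is recovered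
-- from the analogous identity b = 1 + j + #(column-1 entries < b).

open import Defs
open import Data.Empty using (⊥-elim)
open import Data.Fin as Fin using (Fin; zero; suc; toℕ)
open import Data.Fin.Properties as Fin using (toℕ-injective)
open import Data.Integer using (+_; _-_)
open import Data.Integer.Properties using (+-injective; neg-injective; +-0-abelianGroup)
open import Algebra.Properties.AbelianGroup +-0-abelianGroup using (∙-cancelˡ)
open import Data.List using (List; []; _∷_; length; map; filter; tabulate; allFin)
open import Data.List.Properties using (length-map; map-tabulate; filter-accept; filter-reject; filter-none; filter-≐)
open import Data.List.Relation.Unary.All.Properties using (tabulate⁺)
open import Data.Nat using (ℕ; suc; _+_; _≤_; _<_; _≮_; z≤n; s≤s; s≤s⁻¹)
open import Data.Nat.Properties using (_<?_; ≤-refl; ≤-trans; n≤1+n; m<n⇒m<1+n; ≤∧≢⇒<; ≤⇒≯; <-irrefl; <-asym; suc-injective; +-suc; +-cancelˡ-≡)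
open import Data.Product using (_,_; proj₁; proj₂)
open import Data.Sum using (inj₁; inj₂)
open import Function using (_∘_; id; Injective)
open import Relation.Binary using (_Preserves_⟶_)
open import Relation.Binary.PropositionalEquality using (_≡_; _≢_; _≗_; refl; sym; trans; cong; cong₂; subst; module ≡-Reasoning)
open import Relation.Nullary using (Dec; yes; no)
open import Relation.Unary using (Pred; Decidable)

filter-map : ∀ {a b p} {A : Set a} {B : Set b} {P : Pred B p} (P? : Decidable P) (f : A → B) (xs : List A) →
             filter P? (map f xs) ≡ map f (filter (P? ∘ f) xs)
filter-map P? f [] = refl
filter-map P? f (x ∷ xs) with P? (f x)
... | yes _ = cong (f x ∷_) (filter-map P? f xs)
... | no  _ = filter-map P? f xs

module _ {k : ℕ} (c : Fin (suc k) → ℕ) (a : ℕ) where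

  private
    countBelow-tail : length (filter (λ i → c i <? a) (tabulate suc)) ≡ countBelow (c ∘ suc) a
    countBelow-tail = begin
      length (filter (λ i → c i <? a) (tabulate suc))                ≡⟨ cong (length ∘ filter (λ i → c i <? a)) (sym (map-tabulate id suc)) ⟩
      length (filter (λ i → c i <? a) (map suc (allFin k)))          ≡⟨ cong length (filter-map _ suc (allFin k)) ⟩
      length (map suc (filter (λ i → c (suc i) <? a) (allFin k)))    ≡⟨ length-map suc (filter (λ i → c (suc i) <? a) (allFin k)) ⟩
      countBelow (c ∘ suc) a                                         ∎
      where open ≡-Reasoning

  countBelow-accept : c zero < a → countBelow c a ≡ suc (countBelow (c ∘ suc) a)
  countBelow-accept c₀<a = trans (cong length (filter-accept (λ i → c i <? a) c₀<a)) (cong suc countBelow-tail)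

  countBelow-reject : c zero ≮ a → countBelow c a ≡ countBelow (c ∘ suc) a
  countBelow-reject c₀≮a = trans (cong length (filter-reject (λ i → c i <? a) c₀≮a)) countBelow-tail

countBelow-none : ∀ {k} (c : Fin k → ℕ) {a} → (∀ i → c i ≮ a) → countBelow c a ≡ 0
countBelow-none c none = cong length (filter-none (λ i → c i <? _) (tabulate⁺ none))

countBelow-cong : ∀ {k} {c d : Fin k → ℕ} → c ≗ d → ∀ a → countBelow c a ≡ countBelow d a
countBelow-cong {c = c} {d} c≗d a = cong length (filter-≐ (λ i → c i <? a) (λ i → d i <? a)
  ((λ {i} cᵢ<a → subst (_< a) (c≗d i) cᵢ<a) , (λ {i} dᵢ<a → subst (_< a) (sym (c≗d i)) dᵢ<a)) (allFin _))

countBelow-increasing : ∀ {k} (c : Fin k → ℕ) → c Preserves Fin._<_ ⟶ _<_ →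
                        ∀ i → countBelow c (c i) ≡ toℕ i
countBelow-increasing c incr zero =
  trans (countBelow-reject c (c zero) (<-irrefl refl))
        (countBelow-none (c ∘ suc) (λ i → <-asym (incr {zero} {suc i} (s≤s z≤n))))
countBelow-increasing c incr (suc i) =
  trans (countBelow-accept c (c (suc i)) (incr {zero} {suc i} (s≤s z≤n)))
        (cong suc (countBelow-increasing (c ∘ suc) (λ i<j → incr (s≤s i<j)) i))

countBelow-suc-∉ : ∀ {k} (c : Fin k → ℕ) {a} → (∀ i → c i ≢ a) → countBelow c (suc a) ≡ countBelow c a
countBelow-suc-∉ c {a} ∉ = cong length (filter-≐ (λ i → c i <? suc a) (λ i → c i <? a)
  ((λ {i} cᵢ<1+a → ≤∧≢⇒< (s≤s⁻¹ cᵢ<1+a) (∉ i)) , m<n⇒m<1+n) (allFin _))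

countBelow-suc-∈ : ∀ {k} (c : Fin k → ℕ) {a} → Injective _≡_ _≡_ c →
                   ∀ i → c i ≡ a → countBelow c (suc a) ≡ suc (countBelow c a)
countBelow-suc-∈ c {a} inj zero refl = begin
  countBelow c (suc a)              ≡⟨ countBelow-accept c (suc a) ≤-refl ⟩
  suc (countBelow (c ∘ suc) (suc a)) ≡⟨ cong suc (countBelow-suc-∉ (c ∘ suc) (λ i eq → 0≢suc (inj (sym eq)))) ⟩
  suc (countBelow (c ∘ suc) a)       ≡⟨ cong suc (sym (countBelow-reject c a (<-irrefl refl))) ⟩
  suc (countBelow c a)               ∎
  where
  open ≡-Reasoning
  0≢suc : ∀ {k} {i : Fin k} → zero ≢ suc i
  0≢suc ()
countBelow-suc-∈ c {a} inj (suc i) cᵢ≡a = by-cases (c zero <? a)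
  where
  tail-step : countBelow (c ∘ suc) (suc a) ≡ suc (countBelow (c ∘ suc) a)
  tail-step = countBelow-suc-∈ (c ∘ suc) (Fin.suc-injective ∘ inj) i cᵢ≡a
  c₀≢a : c zero ≢ a
  c₀≢a c₀≡a with inj (trans c₀≡a (sym cᵢ≡a))
  ... | ()
  by-cases : Dec (c zero < a) → countBelow c (suc a) ≡ suc (countBelow c a)
  by-cases (yes c₀<a) = trans (countBelow-accept c (suc a) (m<n⇒m<1+n c₀<a))
    (cong suc (trans tail-step (sym (countBelow-accept c a c₀<a))))
  by-cases (no c₀≮a) = trans (countBelow-reject c (suc a) (λ c₀<1+a → c₀≮a (≤∧≢⇒< (s≤s⁻¹ c₀<1+a) c₀≢a)))
    (trans tail-step (cong suc (sym (countBelow-reject c a c₀≮a))))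

module _ {n m : ℕ} {m≤n : m ≤ n} (T : SYT n m m≤n) where

  countBelow-columns : ∀ a → a ≤ n + m → countBelow (col1 T) (suc a) + countBelow (col2 T) (suc a) ≡ a
  countBelow-columns 0 _ = cong₂ _+_
    (countBelow-none (col1 T) (≤⇒≯ ∘ proj₁ ∘ col1-range T))
    (countBelow-none (col2 T) (≤⇒≯ ∘ proj₁ ∘ col2-range T))
  countBelow-columns (suc a) a+1≤n+m =
    trans one-new-entry (cong suc (countBelow-columns a (≤-trans (n≤1+n a) a+1≤n+m)))
    where
    one-new-entry : countBelow (col1 T) (suc (suc a)) + countBelow (col2 T) (suc (suc a))
                  ≡ suc (countBelow (col1 T) (suc a) + countBelow (col2 T) (suc a))
    one-new-entry with surj T (suc a) (s≤s z≤n) a+1≤n+m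
    ... | inj₁ (i , eq) = cong₂ _+_
      (countBelow-suc-∈ (col1 T) (inj1 T _ _) i eq)
      (countBelow-suc-∉ (col2 T) (λ j eq′ → inj12 T i j (trans eq (sym eq′))))
    ... | inj₂ (j , eq) = trans (cong₂ _+_
      (countBelow-suc-∉ (col1 T) (λ i eq′ → inj12 T i j (trans eq′ (sym eq))))
      (countBelow-suc-∈ (col2 T) (inj2 T _ _) j eq)) (+-suc _ _)

  entry-rank : ∀ {x} → 1 ≤ x → x ≤ n + m → suc (countBelow (col1 T) x + countBelow (col2 T) x) ≡ x
  entry-rank {suc a} _ a+1≤n+m = cong suc (countBelow-columns a (≤-trans (n≤1+n a) a+1≤n+m))

  col1-entry : ∀ i → suc (toℕ i + countBelow (col2 T) (col1 T i)) ≡ col1 T i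
  col1-entry i = trans (cong (λ r → suc (r + countBelow (col2 T) (col1 T i))) (sym rank))
                       (entry-rank (proj₁ (col1-range T i)) (proj₂ (col1-range T i)))
    where rank = countBelow-increasing (col1 T) (col1-incr T _ _) i

  col2-entry : ∀ j → suc (countBelow (col1 T) (col2 T j) + toℕ j) ≡ col2 T j
  col2-entry j = trans (cong (λ r → suc (countBelow (col1 T) (col2 T j) + r)) (sym rank))
                       (entry-rank (proj₁ (col2-range T j)) (proj₂ (col2-range T j)))
    where rank = countBelow-increasing (col2 T) (col2-incr T _ _) j

  depSeq-rank : ∀ i → depSeq T i ≡ + toℕ i - + countBelow (col2 T) (col1 T i)
  depSeq-rank i = cong (λ r → + r - + countBelow (col2 T) (col1 T i))
                       (countBelow-increasing (col1 T) (col1-incr T _ _) i)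

module _ {n m : ℕ} {m≤n : m ≤ n} (T U : SYT n m m≤n) where

  col1-determined : (∀ i → depSeq T i ≡ depSeq U i) → ∀ i → col1 T i ≡ col1 U i
  col1-determined same-dep i = begin
    col1 T i                                         ≡⟨ sym (col1-entry T i) ⟩
    suc (toℕ i + countBelow (col2 T) (col1 T i))     ≡⟨ cong (λ r → suc (toℕ i + r)) same-rank ⟩
    suc (toℕ i + countBelow (col2 U) (col1 U i))     ≡⟨ col1-entry U i ⟩
    col1 U i                                         ∎
    where
    open ≡-Reasoning
    same-rank : countBelow (col2 T) (col1 T i) ≡ countBelow (col2 U) (col1 U i)
    same-rank = +-injective (neg-injective (∙-cancelˡ (+ toℕ i) _ _
      (trans (sym (depSeq-rank T i)) (trans (same-dep i) (depSeq-rank U i)))))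

  col2-determined : (∀ i → col1 T i ≡ col1 U i) → ∀ j → col2 T j ≡ col2 U j
  col2-determined same-col1 j with surj U (col2 T j) (proj₁ (col2-range T j)) (proj₂ (col2-range T j))
  ... | inj₁ (i , eq) = ⊥-elim (inj12 T i j (trans (same-col1 i) eq))
  ... | inj₂ (j′ , eq) = trans (sym eq) (cong (col2 U) (toℕ-injective same-row))
    where
    same-count : countBelow (col1 T) (col2 T j) ≡ countBelow (col1 U) (col2 U j′)
    same-count = trans (countBelow-cong same-col1 (col2 T j)) (cong (countBelow (col1 U)) (sym eq))
    same-row : toℕ j′ ≡ toℕ j
    same-row = +-cancelˡ-≡ _ _ _ (suc-injective (begin
      suc (countBelow (col1 T) (col2 T j) + toℕ j′)  ≡⟨ cong (λ r → suc (r + toℕ j′)) same-count ⟩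
      suc (countBelow (col1 U) (col2 U j′) + toℕ j′) ≡⟨ col2-entry U j′ ⟩
      col2 U j′                                      ≡⟨ eq ⟩
      col2 T j                                       ≡⟨ sym (col2-entry T j) ⟩
      suc (countBelow (col1 T) (col2 T j) + toℕ j)   ∎))
      where open ≡-Reasoning

mainTheorem15 : (n m : ℕ) (m≤n : m ≤ n) (T U : SYT n m m≤n) →
                (∀ i → depSeq T i ≡ depSeq U i) → SameTableau T U
mainTheorem15 n m m≤n T U same-dep = same-col1 , col2-determined T U same-col1
  where
  same-col1 : ∀ i → col1 T i ≡ col1 U i
  same-col1 = col1-determined T U same-dep
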